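{- Let $t\geq 2$ be an integer, let $k$ be an odd positive integer, and let $G=D(1,2,\dots,t)$. Then $\mathrm{rl}_k(G)\leq \frac t2 k^2+\frac t2 k$.
   Context: For a finite set $D=\{d_1<\dots<d_m\}$ of positive integers, the distance graph $D(d_1,\dots,d_m)$ has vertex set $\mathbb{Z}$, two distinct integers $i,j$ being adjacent iff $|i-j|\in D$. For a connected graph $G$ with graph distance $d(\cdot,\cdot)$ and an integer $k\ge 1$, a radio $k$-labeling of $G$ is a map $c:V(G)\to\mathbb{Z}_{\ge 0}$ such that $|c(u)-c(v)|\geq k+1-d(u,v)$ for all distinct vertices $u,v$. Its span is $\max\{c(x)-c(y): x,y\in V(G)\}$ (a supremum for infinite graphs), and the radio $k$-labeling number $\mathrm{rl}_k(G)$ is the minimum span over all radio $k$-labelings of $G$. -}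

module Defs where

open import Data.Nat using (ℕ; zero; suc; _+_; _*_; _≤_; _<_; ∣_-_∣)
open import Data.Integer as ℤ using (ℤ)
open import Data.Product using (_×_; ∃-syntax)
open import Relation.Binary.PropositionalEquality using (_≡_; _≢_)
open import Relation.Nullary using (¬_)

Adj : ℕ → ℤ → ℤ → Set
Adj t i j = (1 ≤ ℤ.∣ i ℤ.- j ∣) × (ℤ.∣ i ℤ.- j ∣ ≤ t)

data Walk (t : ℕ) : ℤ → ℤ → ℕ → Set where
  here : ∀ {u} → Walk t u u zero
  step : ∀ {u w v n} → Adj t u w → Walk t w v n → Walk t u v (suc n)

Dist : ℕ → ℤ → ℤ → ℕ → Set
Dist t u v n = Walk t u v n × (∀ m → m < n → ¬ Walk t u v m)

IsRadioLabeling : ℕ → ℕ → (ℤ → ℕ) → Set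
IsRadioLabeling t k c =
  ∀ u v n → u ≢ v → Dist t u v n → k + 1 ≤ ∣ c u - c v ∣ + n

SpanAtMost : (ℤ → ℕ) → ℕ → Set
SpanAtMost c s = ∀ x y → c x ≤ c y + s

-- 2 · span(c) ≤ S  (used to avoid halving); equivalent to span(c) ≤ S/2.
TwiceSpanAtMost : (ℤ → ℕ) → ℕ → Set
TwiceSpanAtMost c S = ∀ x y → 2 * c x ≤ 2 * c y + S

-- rl_k(D(1,…,t)) ≤ S/2, expressed doubled: some radio k-labeling has 2·span ≤ S.
TwiceRlAtMost : ℕ → ℕ → ℕ → Set
TwiceRlAtMost t k S = ∃[ c ] (IsRadioLabeling t k c × TwiceSpanAtMost c S)

-- Write k = 2g + 1 and a = g² + (g + 1)², so that 2a = k² + 1, and put M = k + t a. The labeling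
-- c(x) = a x mod M has span at most M − 1, and 2(M − 1) ≤ t k² + t k as soon as t ≥ 2. For the
-- radio condition let D = u − v ≠ 0 and E = c(u) − c(v); then E ≡ a D (mod M), and the lattice of
-- such pairs (D, E) has the basis (tg + 1, g + 1), (t(g + 1) + 1, −g). Writing (D, E) = x·b₁ + y·b₂,
-- one gets D + tE = x(tk + 1) + y(t + 1) and D − tE = y(tk + 1) − x(t − 1). Whatever the signs of
-- x and y, one of these two combinations has no cancellation, so |D| + t|E| ≥ tk + 1. Since
-- d(u, v) ≥ |D| / t, this gives t(|E| + d(u, v)) > tk, i.e. |E| + d(u, v) ≥ k + 1.
module Submission where

import Data.Nat as ℕ
open ℕ using (ℕ; suc; NonZero; s≤s; z≤n)
import Data.Nat.Properties as ℕₚ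
open import Data.Nat.DivMod using (m≡m%n+[m/n]*n)
import Data.Integer as ℤ
import Data.Integer.Properties as ℤₚ
open import Data.Integer.DivMod using (_%ℕ_; _/ℕ_; a≡a%ℕn+[a/ℕn]*n; n%ℕd<d)
open import Data.Empty using (⊥-elim)
open import Data.Product using (_×_; _,_; ∃-syntax)
open import Data.Sum using (_⊎_; inj₁; inj₂)
open import Relation.Binary.PropositionalEquality
open import Relation.Nullary using (¬_)

open import Defs

multiplier : ℕ → ℕ
multiplier g = g ℕ.* g ℕ.+ suc g ℕ.* suc g

modulus : ℕ → ℕ → ℕ
modulus t g = suc (g ℕ.* 2) ℕ.+ t ℕ.* multiplier g

module _ where
  open ℤ using (ℤ; +_; +0; +[1+_]; -[1+_]; 0ℤ; 1ℤ; _+_; _-_; _*_; -_; ∣_∣)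
  open import Data.Integer.Tactic.RingSolver using (solve-∀)

  ∣+m-+n∣≡∣m-n∣ : ∀ m n → ∣ + m - + n ∣ ≡ ℕ.∣ m - n ∣
  ∣+m-+n∣≡∣m-n∣ m n with ℕₚ.≤-total m n
  ... | inj₁ m≤n = begin
    ∣ + m - + n ∣  ≡⟨ cong ∣_∣ (ℤₚ.m-n≡m⊖n m n) ⟩
    ∣ m ℤ.⊖ n ∣    ≡⟨ ℤₚ.∣⊖∣-≤ m≤n ⟩
    n ℕ.∸ m        ≡⟨ ℕₚ.m≤n⇒∣m-n∣≡n∸m m≤n ⟨
    ℕ.∣ m - n ∣    ∎
    where open ≡-Reasoning
  ... | inj₂ n≤m = begin
    ∣ + m - + n ∣  ≡⟨ cong ∣_∣ (ℤₚ.m-n≡m⊖n m n) ⟩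
    ∣ m ℤ.⊖ n ∣    ≡⟨ ℤₚ.∣m⊖n∣≡∣n⊖m∣ m n ⟩
    ∣ n ℤ.⊖ m ∣    ≡⟨ ℤₚ.∣⊖∣-≤ n≤m ⟩
    m ℕ.∸ n        ≡⟨ ℕₚ.m≤n⇒∣n-m∣≡n∸m n≤m ⟨
    ℕ.∣ m - n ∣    ∎
    where open ≡-Reasoning

  walk⇒∣i-j∣≤n*t : ∀ {t i j n} → Walk t i j n → ∣ i - j ∣ ℕ.≤ n ℕ.* t
  walk⇒∣i-j∣≤n*t {i = i} here = ℕₚ.≤-reflexive (cong ∣_∣ (ℤₚ.+-inverseʳ i))
  walk⇒∣i-j∣≤n*t {i = i} {j} (step {w = w} (_ , ∣i-w∣≤t) walk) = begin
    ∣ i - j ∣                ≡⟨ cong ∣_∣ (split i w j) ⟩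
    ∣ (i - w) + (w - j) ∣    ≤⟨ ℤₚ.∣i+j∣≤∣i∣+∣j∣ (i - w) (w - j) ⟩
    ∣ i - w ∣ ℕ.+ ∣ w - j ∣  ≤⟨ ℕₚ.+-mono-≤ ∣i-w∣≤t (walk⇒∣i-j∣≤n*t walk) ⟩
    _                        ∎
    where
    open ℕₚ.≤-Reasoning
    split : ∀ i w j → i - j ≡ (i - w) + (w - j)
    split = solve-∀

  pos-combination : ∀ a b c d → + a * + b + + c * + d ≡ + (a ℕ.* b ℕ.+ c ℕ.* d)
  pos-combination a b c d = begin
    + a * + b + + c * + d          ≡⟨ cong₂ _+_ (ℤₚ.pos-* a b) (ℤₚ.pos-* c d) ⟨
    + (a ℕ.* b) + + (c ℕ.* d)      ≡⟨ ℤₚ.pos-+ (a ℕ.* b) (c ℕ.* d) ⟨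
    + (a ℕ.* b ℕ.+ c ℕ.* d)        ∎
    where open ≡-Reasoning

  K≤∣[1+x]K+yp∣ : ∀ K p x y → K ℕ.≤ ∣ + suc x * + K + + y * + p ∣
  K≤∣[1+x]K+yp∣ K p x y rewrite pos-combination (suc x) K y p =
    ℕₚ.≤-trans (ℕₚ.m≤m+n K (x ℕ.* K)) (ℕₚ.m≤m+n _ (y ℕ.* p))

  K≤∣-[[1+x]K+yp]∣ : ∀ K p x y → K ℕ.≤ ∣ - (+ suc x * + K + + y * + p) ∣
  K≤∣-[[1+x]K+yp]∣ K p x y rewrite ℤₚ.∣-i∣≡∣i∣ (+ suc x * + K + + y * + p) = K≤∣[1+x]K+yp∣ K p x y

  private
    neg-sum : ∀ a b c d → (- a) * b + (- c) * d ≡ - (a * b + c * d)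
    neg-sum = solve-∀

    minus-neg : ∀ a b c d → a * b - (- c) * d ≡ a * b + c * d
    minus-neg = solve-∀

    neg-minus : ∀ a b c d → (- a) * b - c * d ≡ - (a * b + c * d)
    neg-minus = solve-∀

  K≤∣xK+yp∣⊎K≤∣yK-xq∣ : ∀ K p q x y → ¬ (x ≡ 0ℤ × y ≡ 0ℤ) →
    K ℕ.≤ ∣ x * + K + y * + p ∣ ⊎ K ℕ.≤ ∣ y * + K - x * + q ∣
  K≤∣xK+yp∣⊎K≤∣yK-xq∣ K p q +[1+ x ] (+ y)    _ = inj₁ (K≤∣[1+x]K+yp∣ K p x y)
  K≤∣xK+yp∣⊎K≤∣yK-xq∣ K p q -[1+ x ] +0       _ =
    inj₁ (subst (λ z → K ℕ.≤ ∣ z ∣) (sym (neg-sum (+ suc x) (+ K) +0 (+ p)))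
      (K≤∣-[[1+x]K+yp]∣ K p x 0))
  K≤∣xK+yp∣⊎K≤∣yK-xq∣ K p q -[1+ x ] -[1+ y ] _ =
    inj₁ (subst (λ z → K ℕ.≤ ∣ z ∣) (sym (neg-sum (+ suc x) (+ K) (+ suc y) (+ p)))
      (K≤∣-[[1+x]K+yp]∣ K p x (suc y)))
  K≤∣xK+yp∣⊎K≤∣yK-xq∣ K p q +0       +[1+ y ] _ =
    inj₂ (subst (λ z → K ℕ.≤ ∣ z ∣) (sym (minus-neg (+ suc y) (+ K) +0 (+ q)))
      (K≤∣[1+x]K+yp∣ K q y 0))
  K≤∣xK+yp∣⊎K≤∣yK-xq∣ K p q -[1+ x ] +[1+ y ] _ =
    inj₂ (subst (λ z → K ℕ.≤ ∣ z ∣) (sym (minus-neg (+ suc y) (+ K) (+ suc x) (+ q)))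
      (K≤∣[1+x]K+yp∣ K q y (suc x)))
  K≤∣xK+yp∣⊎K≤∣yK-xq∣ K p q (+ x)    -[1+ y ] _ =
    inj₂ (subst (λ z → K ℕ.≤ ∣ z ∣) (sym (neg-minus (+ suc y) (+ K) (+ x) (+ q)))
      (K≤∣-[[1+x]K+yp]∣ K q y x))
  K≤∣xK+yp∣⊎K≤∣yK-xq∣ K p q +0       +0       x,y≢0 = ⊥-elim (x,y≢0 (refl , refl))

  +[1+g*2]≡1+G*2 : ∀ g → + suc (g ℕ.* 2) ≡ 1ℤ + + g * + 2
  +[1+g*2]≡1+G*2 g = trans (ℤₚ.pos-+ 1 (g ℕ.* 2)) (cong (λ n → 1ℤ + n) (ℤₚ.pos-* g 2))

  +multiplier≡ : ∀ g → + multiplier g ≡ + g * + g + (1ℤ + + g) * (1ℤ + + g)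
  +multiplier≡ g = begin
    + multiplier g                             ≡⟨ ℤₚ.pos-+ (g ℕ.* g) (suc g ℕ.* suc g) ⟩
    + (g ℕ.* g) + + (suc g ℕ.* suc g)          ≡⟨ cong₂ _+_ (ℤₚ.pos-* g g) (ℤₚ.pos-* (suc g) (suc g)) ⟩
    + g * + g + + suc g * + suc g              ≡⟨ cong (λ h → + g * + g + h * h) (ℤₚ.pos-+ 1 g) ⟩
    + g * + g + (1ℤ + + g) * (1ℤ + + g)        ∎
    where open ≡-Reasoning

  +modulus≡ : ∀ t g → + modulus t g ≡ (1ℤ + + g * + 2) + + t * (+ g * + g + (1ℤ + + g) * (1ℤ + + g))
  +modulus≡ t g = trans (ℤₚ.pos-+ (suc (g ℕ.* 2)) (t ℕ.* multiplier g))
    (cong₂ _+_ (+[1+g*2]≡1+G*2 g)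
      (trans (ℤₚ.pos-* t (multiplier g)) (cong (λ n → + t * n) (+multiplier≡ g))))

  -- The vectors (tg + 1, g + 1) and (t(g + 1) + 1, −g) form a basis of the lattice
  -- {(D, E) : E ≡ a D (mod M)} with a = multiplier g and M = modulus t g.
  latticeD latticeE : ℕ → ℕ → ℤ → ℤ → ℤ
  latticeD t g x y = (+ t * + g + 1ℤ) * x + (+ t * (1ℤ + + g) + 1ℤ) * y
  latticeE t g x y = (1ℤ + + g) * x - + g * y

  lattice-spanned : ∀ t g D m → ∃[ x ] ∃[ y ]
    (latticeD t g x y ≡ D × latticeE t g x y ≡ + multiplier g * D - + modulus t g * m)
  lattice-spanned t g D m = x , y , D-coordinate (+ t) (+ g) D m , (begin
      latticeE t g x y
        ≡⟨ E-coordinate (+ t) (+ g) D m ⟩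
      (+ g * + g + (1ℤ + + g) * (1ℤ + + g)) * D
        - ((1ℤ + + g * + 2) + + t * (+ g * + g + (1ℤ + + g) * (1ℤ + + g))) * m
        ≡⟨ cong₂ (λ a M → a * D - M * m) (+multiplier≡ g) (+modulus≡ t g) ⟨
      + multiplier g * D - + modulus t g * m
        ∎)
    where
    open ≡-Reasoning
    x y : ℤ
    x = (1ℤ + + g) * D - (+ t * (1ℤ + + g) + 1ℤ) * m
    y = (+ t * + g + 1ℤ) * m - + g * D

    D-coordinate : ∀ T G D m →
      (T * G + 1ℤ) * ((1ℤ + G) * D - (T * (1ℤ + G) + 1ℤ) * m)
        + (T * (1ℤ + G) + 1ℤ) * ((T * G + 1ℤ) * m - G * D) ≡ D
    D-coordinate = solve-∀

    E-coordinate : ∀ T G D m →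
      (1ℤ + G) * ((1ℤ + G) * D - (T * (1ℤ + G) + 1ℤ) * m) - G * ((T * G + 1ℤ) * m - G * D)
        ≡ (G * G + (1ℤ + G) * (1ℤ + G)) * D - ((1ℤ + G * + 2) + T * (G * G + (1ℤ + G) * (1ℤ + G))) * m
    E-coordinate = solve-∀

  latticeD+t*latticeE≡ : ∀ t g x y →
    latticeD t g x y + + t * latticeE t g x y ≡ x * (1ℤ + + t * (1ℤ + + g * + 2)) + y * (1ℤ + + t)
  latticeD+t*latticeE≡ t g = identity (+ t) (+ g)
    where
    identity : ∀ T G x y →
      ((T * G + 1ℤ) * x + (T * (1ℤ + G) + 1ℤ) * y) + T * ((1ℤ + G) * x - G * y)
        ≡ x * (1ℤ + T * (1ℤ + G * + 2)) + y * (1ℤ + T)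
    identity = solve-∀

  latticeD-t*latticeE≡ : ∀ t g x y →
    latticeD t g x y - + t * latticeE t g x y ≡ y * (1ℤ + + t * (1ℤ + + g * + 2)) - x * (+ t - 1ℤ)
  latticeD-t*latticeE≡ t g = identity (+ t) (+ g)
    where
    identity : ∀ T G x y →
      ((T * G + 1ℤ) * x + (T * (1ℤ + G) + 1ℤ) * y) - T * ((1ℤ + G) * x - G * y)
        ≡ y * (1ℤ + T * (1ℤ + G * + 2)) - x * (T - 1ℤ)
    identity = solve-∀

  ∣i+tj∣≤∣i∣+t∣j∣ : ∀ t i j → ∣ i + + t * j ∣ ℕ.≤ ∣ i ∣ ℕ.+ t ℕ.* ∣ j ∣
  ∣i+tj∣≤∣i∣+t∣j∣ t i j = subst (∣ i + + t * j ∣ ℕ.≤_) (cong (∣ i ∣ ℕ.+_) (ℤₚ.abs-* (+ t) j))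
    (ℤₚ.∣i+j∣≤∣i∣+∣j∣ i (+ t * j))

  ∣i-tj∣≤∣i∣+t∣j∣ : ∀ t i j → ∣ i - + t * j ∣ ℕ.≤ ∣ i ∣ ℕ.+ t ℕ.* ∣ j ∣
  ∣i-tj∣≤∣i∣+t∣j∣ t i j = subst (∣ i - + t * j ∣ ℕ.≤_) (cong (∣ i ∣ ℕ.+_) (ℤₚ.abs-* (+ t) j))
    (ℤₚ.∣i-j∣≤∣i∣+∣j∣ i (+ t * j))

  latticeD≢0⇒tk<∣D∣+t∣E∣ : ∀ t g .{{_ : NonZero t}} x y → latticeD t g x y ≢ 0ℤ →
    t ℕ.* suc (g ℕ.* 2) ℕ.< ∣ latticeD t g x y ∣ ℕ.+ t ℕ.* ∣ latticeE t g x y ∣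
  latticeD≢0⇒tk<∣D∣+t∣E∣ t@(suc t₁) g x y D≢0 =
    large⇒gap (K≤∣xK+yp∣⊎K≤∣yK-xq∣ K (suc t) t₁ x y x,y≢0)
    where
    K : ℕ
    K = suc (t ℕ.* suc (g ℕ.* 2))
    D E : ℤ
    D = latticeD t g x y
    E = latticeE t g x y

    x,y≢0 : ¬ (x ≡ 0ℤ × y ≡ 0ℤ)
    x,y≢0 (x≡0 , y≡0) = D≢0 (trans (cong₂ (latticeD t g) x≡0 y≡0)
      (cong₂ _+_ (ℤₚ.*-zeroʳ (+ t * + g + 1ℤ)) (ℤₚ.*-zeroʳ (+ t * (1ℤ + + g) + 1ℤ))))

    +K≡ : + K ≡ 1ℤ + + t * (1ℤ + + g * + 2)
    +K≡ = trans (ℤₚ.pos-+ 1 (t ℕ.* suc (g ℕ.* 2))) (cong (λ n → 1ℤ + n)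
      (trans (ℤₚ.pos-* t (suc (g ℕ.* 2))) (cong (λ n → + t * n) (+[1+g*2]≡1+G*2 g))))

    large⇒gap : K ℕ.≤ ∣ x * + K + y * + suc t ∣ ⊎ K ℕ.≤ ∣ y * + K - x * + t₁ ∣ →
      K ℕ.≤ ∣ D ∣ ℕ.+ t ℕ.* ∣ E ∣
    large⇒gap (inj₁ K≤∣xK+yp∣) = ℕₚ.≤-trans
      (subst (λ z → K ℕ.≤ ∣ z ∣)
        (trans (cong₂ (λ K p → x * K + y * p) +K≡ (ℤₚ.pos-+ 1 t)) (sym (latticeD+t*latticeE≡ t g x y)))
        K≤∣xK+yp∣)
      (∣i+tj∣≤∣i∣+t∣j∣ t D E)
    large⇒gap (inj₂ K≤∣yK-xq∣) = ℕₚ.≤-trans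
      (subst (λ z → K ℕ.≤ ∣ z ∣)
        (trans (cong (λ K → y * K - x * + t₁) +K≡) (sym (latticeD-t*latticeE≡ t g x y)))
        K≤∣yK-xq∣)
      (∣i-tj∣≤∣i∣+t∣j∣ t D E)

  D≢0⇒tk<∣D∣+t∣aD-Mm∣ : ∀ t g .{{_ : NonZero t}} D m → D ≢ 0ℤ →
    t ℕ.* suc (g ℕ.* 2) ℕ.< ∣ D ∣ ℕ.+ t ℕ.* ∣ + multiplier g * D - + modulus t g * m ∣
  D≢0⇒tk<∣D∣+t∣aD-Mm∣ t g D m D≢0 with lattice-spanned t g D m
  ... | x , y , refl , E≡ =
    subst (λ E → _ ℕ.< ∣ D ∣ ℕ.+ t ℕ.* ∣ E ∣) E≡ (latticeD≢0⇒tk<∣D∣+t∣E∣ t g x y D≢0)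

  label : ℕ → ℕ → ℤ → ℕ
  label t g x = (+ multiplier g * x) %ℕ modulus t g

  quotient : ℕ → ℕ → ℤ → ℤ
  quotient t g x = (+ multiplier g * x) /ℕ modulus t g

  ∣aD-Mm∣≡∣label-label∣ : ∀ t g u v →
    ∣ + multiplier g * (u - v) - + modulus t g * (quotient t g u - quotient t g v) ∣
      ≡ ℕ.∣ label t g u - label t g v ∣
  ∣aD-Mm∣≡∣label-label∣ t g u v = begin
    ∣ a * (u - v) - M * (qu - qv) ∣              ≡⟨ cong ∣_∣ (regroup a u v qu qv M) ⟩
    ∣ (a * u - qu * M) - (a * v - qv * M) ∣      ≡⟨ cong₂ (λ r s → ∣ r - s ∣) (residue u) (residue v) ⟨
    ∣ + label t g u - + label t g v ∣            ≡⟨ ∣+m-+n∣≡∣m-n∣ (label t g u) (label t g v) ⟩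
    ℕ.∣ label t g u - label t g v ∣              ∎
    where
    open ≡-Reasoning
    a M qu qv : ℤ
    a = + multiplier g
    M = + modulus t g
    qu = quotient t g u
    qv = quotient t g v

    regroup : ∀ a u v q r M → a * (u - v) - M * (q - r) ≡ (a * u - q * M) - (a * v - r * M)
    regroup = solve-∀

    subtract : ∀ r q M → r ≡ (r + q * M) - q * M
    subtract = solve-∀

    residue : ∀ x → + label t g x ≡ a * x - quotient t g x * M
    residue x = trans (subtract _ (quotient t g x) M)
      (cong (λ z → z - quotient t g x * M) (sym (a≡a%ℕn+[a/ℕn]*n (a * x) (modulus t g))))

open import Data.Nat using (_+_; _*_; _≤_; _<_; _%_; _/_; ∣_-_∣)
open import Data.Nat.Tactic.RingSolver using (solve-∀)

label-isRadioLabeling : ∀ t g .{{_ : NonZero t}} → IsRadioLabeling t (suc (g * 2)) (label t g)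
label-isRadioLabeling t g u v n u≢v (walk , _) =
  subst (_≤ e + n) (ℕₚ.+-comm 1 k) (ℕₚ.*-cancelˡ-< t k (e + n) tk<t[e+n])
  where
  open ℕₚ.≤-Reasoning
  k e : ℕ
  k = suc (g * 2)
  e = ∣ label t g u - label t g v ∣

  D≢0 : u ℤ.- v ≢ ℤ.0ℤ
  D≢0 u-v≡0 = u≢v (ℤₚ.i-j≡0⇒i≡j u v u-v≡0)

  tk<t[e+n] : t * k < t * (e + n)
  tk<t[e+n] = begin-strict
    t * k                      <⟨ gap ⟩
    ℤ.∣ u ℤ.- v ∣ + t * e      ≤⟨ ℕₚ.+-monoˡ-≤ (t * e) (walk⇒∣i-j∣≤n*t walk) ⟩
    n * t + t * e              ≡⟨ distribute n t e ⟩
    t * (e + n)                ∎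
    where
    gap : t * k < ℤ.∣ u ℤ.- v ∣ + t * e
    gap = subst (λ z → t * k < ℤ.∣ u ℤ.- v ∣ + t * z) (∣aD-Mm∣≡∣label-label∣ t g u v)
      (D≢0⇒tk<∣D∣+t∣aD-Mm∣ t g (u ℤ.- v) _ D≢0)
    distribute : ∀ n t e → n * t + t * e ≡ t * (e + n)
    distribute = solve-∀

label-twiceSpan : ∀ t g → 2 ≤ t →
  TwiceSpanAtMost (label t g) (t * (suc (g * 2) * suc (g * 2)) + t * suc (g * 2))
label-twiceSpan t@(suc (suc t₂)) g (s≤s (s≤s z≤n)) x y = begin
  2 * label t g x                                    ≤⟨ ℕₚ.*-monoʳ-≤ 2 (ℕₚ.≤-pred label<modulus) ⟩
  2 * (g * 2 + t * multiplier g)                     ≤⟨ ℕₚ.m≤m+n _ (2 * g * t₂) ⟩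
  2 * (g * 2 + t * multiplier g) + 2 * g * t₂        ≡⟨ identity t₂ g ⟨
  S                                                  ≤⟨ ℕₚ.m≤n+m S (2 * label t g y) ⟩
  2 * label t g y + S                                ∎
  where
  open ℕₚ.≤-Reasoning
  S : ℕ
  S = t * (suc (g * 2) * suc (g * 2)) + t * suc (g * 2)
  label<modulus : label t g x < modulus t g
  label<modulus = n%ℕd<d (ℤ.+ multiplier g ℤ.* x) (modulus t g)
  identity : ∀ t₂ g →
    (2 + t₂) * ((1 + g * 2) * (1 + g * 2)) + (2 + t₂) * (1 + g * 2)
      ≡ 2 * (g * 2 + (2 + t₂) * (g * g + (1 + g) * (1 + g))) + 2 * g * t₂
  identity = solve-∀

theorem3 : (t k : ℕ) → 2 ≤ t → k % 2 ≡ 1 →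
    TwiceRlAtMost t k (t * (k * k) + t * k)
theorem3 t k 2≤t k-odd = subst (λ k → TwiceRlAtMost t k (t * (k * k) + t * k)) (sym k≡1+g*2)
  (label t g , label-isRadioLabeling t g , label-twiceSpan t g 2≤t)
  where
  g : ℕ
  g = k / 2
  k≡1+g*2 : k ≡ suc (g * 2)
  k≡1+g*2 = trans (m≡m%n+[m/n]*n k 2) (cong (_+ g * 2) k-odd)
  instance
    t≢0 : NonZero t
    t≢0 = ℕ.>-nonZero (ℕₚ.≤-trans (s≤s z≤n) 2≤t)
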